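{- Let $A=\{\mathbf a_1,\dots,\mathbf a_n\}\subset\mathbb Z^d$ be a finite set generating $\mathbb Z^d$ as a lattice, let $Q$ be the semigroup generated by $A$, let $K=\mathrm{cone}(A)$, assumed pointed with non-empty interior, and let $B$ be the Hilbert basis of $K$. A face $F$ of $K$ is nowhere saturated if and only if for some element $\mathbf b\in B$ the system $$\mathbf b=x_1\mathbf a_1+\dots+x_n\mathbf a_n,\quad x_j\in\mathbb Z\ \text{for all } j,\ \text{and } x_j\ge 0 \text{ for every } j \text{ with } \mathbf a_j\notin F$$ does not have a feasible solution.
   Context: $Q=\{\sum_i\lambda_i\mathbf a_i:\lambda_i\in\mathbb N\}$, $K=\{\sum_i\lambda_i\mathbf a_i:\lambda_i\in\mathbb R_{\ge0}\}$, $Q_{\rm sat}=K\cap\mathbb Z^d$. The Hilbert basis $B$ of $K$ is the unique minimal finite subset of $K\cap\mathbb Z^d$ generating $K\cap\mathbb Z^d$ as a semigroup. A point $\mathbf a\in Q$ is a saturation point if $\mathbf a+Q_{\rm sat}\subset Q$. A face $F$ of $K$ is almost saturated if it contains a saturation point of $Q$, and nowhere saturated otherwise. -}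

module Defs where

open import Data.Nat using (ℕ; suc)
open import Data.Integer as ℤ using (ℤ; +_; _≤_)
open import Data.Fin using (Fin; zero; suc)
open import Data.Vec using (Vec; []; _∷_; zipWith; replicate; map)
open import Data.Product using (Σ; ∃; _×_; _,_)
open import Data.List using (List)
open import Data.List.Membership.Propositional using (_∈_)
open import Relation.Binary.PropositionalEquality using (_≡_; _≢_)
open import Relation.Nullary using (¬_)

Vecℤ : ℕ → Set
Vecℤ d = Vec ℤ d

0ᵥ : ∀ {d} → Vecℤ d
0ᵥ = replicate _ (+ 0)

_+ᵥ_ : ∀ {d} → Vecℤ d → Vecℤ d → Vecℤ d
_+ᵥ_ = zipWith ℤ._+_

-ᵥ_ : ∀ {d} → Vecℤ d → Vecℤ d
-ᵥ_ = map (λ z → ℤ.- z)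

_·ᵥ_ : ∀ {d} → ℤ → Vecℤ d → Vecℤ d
k ·ᵥ v = map (k ℤ.*_) v

dot : ∀ {d} → Vecℤ d → Vecℤ d → ℤ
dot [] [] = + 0
dot (x ∷ xs) (y ∷ ys) = x ℤ.* y ℤ.+ dot xs ys

lincomb : ∀ {d n} → (Fin n → ℤ) → Vec (Vecℤ d) n → Vecℤ d
lincomb x [] = 0ᵥ
lincomb x (a ∷ as) = (x zero ·ᵥ a) +ᵥ lincomb (λ j → x (suc j)) as

natcomb : ∀ {d n} → (Fin n → ℕ) → Vec (Vecℤ d) n → Vecℤ d
natcomb λs A = lincomb (λ j → + (λs j)) A

InQ : ∀ {d n} → Vec (Vecℤ d) n → Vecℤ d → Set
InQ A x = ∃ λ (λs : Fin _ → ℕ) → x ≡ natcomb λs A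

-- An integer point lies in the real cone
-- cone(A) iff it is a nonnegative rational combination of A, i.e. iff some
-- positive multiple (m+1)·x is a natural combination of A.
InQsat : ∀ {d n} → Vec (Vecℤ d) n → Vecℤ d → Set
InQsat A x = Σ ℕ λ m → ∃ λ (λs : Fin _ → ℕ) → ((+ (suc m)) ·ᵥ x) ≡ natcomb λs A

GeneratesLattice : ∀ {d n} → Vec (Vecℤ d) n → Set
GeneratesLattice {d} A = ∀ (x : Vecℤ d) → ∃ λ (μ : Fin _ → ℤ) → x ≡ lincomb μ A

Pointed : ∀ {d n} → Vec (Vecℤ d) n → Set
Pointed A = ∀ x → InQsat A x → InQsat A (-ᵥ x) → x ≡ 0ᵥ

-- K has nonempty interior: K − K = ℝ^d (checked on lattice points)
FullDim : ∀ {d n} → Vec (Vecℤ d) n → Set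
FullDim {d} A = ∀ (x : Vecℤ d) → ∃ λ y → ∃ λ z →
  InQsat A y × InQsat A z × x ≡ y +ᵥ (-ᵥ z)

data Gen {d} (P : Vecℤ d → Set) : Vecℤ d → Set where
  gen-zero : Gen P 0ᵥ
  gen-add  : ∀ {b x} → P b → Gen P x → Gen P (b +ᵥ x)

IsHilbertBasis : ∀ {d n} → Vec (Vecℤ d) n → List (Vecℤ d) → Set
IsHilbertBasis A B =
  (∀ {b} → b ∈ B → InQsat A b) ×
  (∀ x → InQsat A x → Gen (_∈ B) x) ×
  (∀ {b} → b ∈ B → ¬ (∀ x → InQsat A x → Gen (λ y → y ∈ B × y ≢ b) x))

-- A face of K, given by an integral supporting functional c ≥ 0 on A:
-- F = { x ∈ K : c·x = 0 }.
IsFaceFunctional : ∀ {d n} → Vec (Vecℤ d) n → Vecℤ d → Set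
IsFaceFunctional {n = n} A c = ∀ (j : Fin n) → + 0 ≤ dot c (Data.Vec.lookup A j)

IsSaturationPoint : ∀ {d n} → Vec (Vecℤ d) n → Vecℤ d → Set
IsSaturationPoint A a = InQ A a × (∀ y → InQsat A y → InQ A (a +ᵥ y))

AlmostSaturated : ∀ {d n} → Vec (Vecℤ d) n → Vecℤ d → Set
AlmostSaturated A c = ∃ λ a → IsSaturationPoint A a × dot c a ≡ + 0

NowhereSaturated : ∀ {d n} → Vec (Vecℤ d) n → Vecℤ d → Set
NowhereSaturated A c = ¬ AlmostSaturated A c

-- The system b = Σ x_j a_j, x_j ∈ ℤ, x_j ≥ 0 whenever a_j ∉ F_c
-- (for a_j ∈ K, a_j ∉ F_c iff c·a_j ≠ 0).
Feasible : ∀ {d n} → Vec (Vecℤ d) n → Vecℤ d → Vecℤ d → Set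
Feasible {n = n} A c b = ∃ λ (x : Fin n → ℤ) →
  b ≡ lincomb x A ×
  (∀ (j : Fin n) → dot c (Data.Vec.lookup A j) ≢ + 0 → + 0 ≤ x j)

-- A saturation point a ∈ Q ∩ F gives a + b ∈ Q for every b ∈ Q_sat, so every b is a difference
-- z′ − z of points z′ ∈ Q, z ∈ Q ∩ F; such differences are exactly the feasible b, because the
-- coefficients of z on generators off F must vanish.  Conversely, if every Hilbert basis element
-- b is such a difference and (m + 1) b ∈ Q, then m z + k b ∈ Q for all k, so the sum of the m z
-- over the basis is a saturation point on F.  To exhibit an infeasible basis element
-- constructively, feasibility is decided: the coefficients off F are bounded by c·b, and what
-- remains is membership in the lattice spanned by the generators on F, decided by gcd column
-- reduction.
{-# OPTIONS --safe #-}
module Submission where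

open import Defs
open import Data.Nat using (ℕ)
open import Data.Vec using (Vec)
open import Data.List using (List)
open import Data.List.Membership.Propositional using (_∈_)
open import Data.Product using (∃; _×_)
open import Relation.Nullary using (¬_)
open import Function.Bundles using (_⇔_)

open import Level using (0ℓ)
open import Data.Bool using (Bool; true; false; if_then_else_)
open import Data.Nat as ℕ using (zero; suc; z≤n; s≤s; _∸_; _%_; _/_)
import Data.Nat.Properties as ℕP
open import Data.Nat.DivMod using (m≡m%n+[m/n]*n; m%n<n)
open import Data.Nat.GCD using (gcd-GCD; module Bézout)
open import Data.Integer as ℤ using (ℤ; +_; -[1+_]; 0ℤ; 1ℤ; -1ℤ; -_; _+_; _-_; _*_; _≤_; ∣_∣; +≤+)
import Data.Integer.Properties as ℤP
open import Data.Integer.GCD using (gcd; gcd[i,j]∣i; gcd[i,j]∣j)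
open import Data.Integer.Divisibility.Signed using (divides; _∣?_; ∣ᵤ⇒∣)
open import Data.Integer.Tactic.RingSolver using (solve-∀)
open import Algebra.Properties.CommutativeSemigroup ℤP.+-commutativeSemigroup using (interchange; x∙yz≈y∙xz)
open import Algebra.Properties.Monoid.Sum ℤP.+-0-monoid using (sum; sum-cong-≗; sum-replicate-zero)
open import Data.Fin using (Fin; zero; suc; toℕ; fromℕ<)
open import Data.Fin.Properties using (any?; toℕ-fromℕ<)
open import Data.Vec using ([]; _∷_; lookup; map; tabulate)
open import Data.Vec.Properties using (lookup∘tabulate; ∷-injective)
open import Data.Vec.Functional using () renaming (_∷_ to _◂_)
open import Data.List using ([]; _∷_)
import Data.List.Relation.Unary.All as All
open import Data.List.Relation.Unary.All.Properties using (¬All⇒Any¬)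
open import Data.List.Relation.Unary.Any using (here; there)
open import Data.List.Membership.Propositional using (find)
open import Data.Product using (∃₂; _,_; proj₁; proj₂)
open import Data.Sum using (inj₁; inj₂)
open import Function using (_∘_; const)
open import Function.Bundles using (mk⇔; Equivalence)
open import Relation.Nullary using (Dec; yes; no; does; contradiction)
open import Relation.Nullary.Decidable using (map′; dec-true; dec-false; _×-dec_)
open import Relation.Unary using (Pred; Decidable; _⊆_; _≐_)
open import Relation.Unary.Properties using (≐-trans)
open import Relation.Binary.PropositionalEquality

open Equivalence using (to; from)

private
  variable
    d k m n : ℕ

+ᵥ-assoc : (u v w : Vecℤ d) → ((u +ᵥ v) +ᵥ w) ≡ (u +ᵥ (v +ᵥ w))
+ᵥ-assoc [] [] [] = refl
+ᵥ-assoc (a ∷ u) (b ∷ v) (c ∷ w) = cong₂ _∷_ (ℤP.+-assoc a b c) (+ᵥ-assoc u v w)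

+ᵥ-identityˡ : (v : Vecℤ d) → (0ᵥ +ᵥ v) ≡ v
+ᵥ-identityˡ [] = refl
+ᵥ-identityˡ (a ∷ v) = cong₂ _∷_ (ℤP.+-identityˡ a) (+ᵥ-identityˡ v)

+ᵥ-identityʳ : (v : Vecℤ d) → (v +ᵥ 0ᵥ) ≡ v
+ᵥ-identityʳ [] = refl
+ᵥ-identityʳ (a ∷ v) = cong₂ _∷_ (ℤP.+-identityʳ a) (+ᵥ-identityʳ v)

+ᵥ-leftComm : (u v w : Vecℤ d) → (u +ᵥ (v +ᵥ w)) ≡ (v +ᵥ (u +ᵥ w))
+ᵥ-leftComm [] [] [] = refl
+ᵥ-leftComm (a ∷ u) (b ∷ v) (c ∷ w) = cong₂ _∷_ (x∙yz≈y∙xz a b c) (+ᵥ-leftComm u v w)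

+ᵥ-interchange : (u v w x : Vecℤ d) → ((u +ᵥ v) +ᵥ (w +ᵥ x)) ≡ ((u +ᵥ w) +ᵥ (v +ᵥ x))
+ᵥ-interchange [] [] [] [] = refl
+ᵥ-interchange (a ∷ u) (b ∷ v) (c ∷ w) (e ∷ x) = cong₂ _∷_ (interchange a b c e) (+ᵥ-interchange u v w x)

u+v-u≡v : (u v : Vecℤ d) → ((u +ᵥ v) +ᵥ (-ᵥ u)) ≡ v
u+v-u≡v [] [] = refl
u+v-u≡v (a ∷ u) (b ∷ v) = cong₂ _∷_ (lemma a b) (u+v-u≡v u v)
  where
  lemma : ∀ a b → (a + b) - a ≡ b
  lemma = solve-∀

u+[v-u]≡v : (u v : Vecℤ d) → (u +ᵥ (v +ᵥ (-ᵥ u))) ≡ v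
u+[v-u]≡v [] [] = refl
u+[v-u]≡v (a ∷ u) (b ∷ v) = cong₂ _∷_ (lemma a b) (u+[v-u]≡v u v)
  where
  lemma : ∀ a b → a + (b - a) ≡ b
  lemma = solve-∀

+ᵥ-cancelˡ : (u v w : Vecℤ d) → (u +ᵥ v) ≡ (u +ᵥ w) → v ≡ w
+ᵥ-cancelˡ u v w eq = begin
  v                        ≡⟨ u+v-u≡v u v ⟨
  (u +ᵥ v) +ᵥ (-ᵥ u)       ≡⟨ cong (_+ᵥ (-ᵥ u)) eq ⟩
  (u +ᵥ w) +ᵥ (-ᵥ u)       ≡⟨ u+v-u≡v u w ⟩
  w                        ∎
  where open ≡-Reasoning

·ᵥ-distribˡ : ∀ k (u v : Vecℤ d) → (k ·ᵥ (u +ᵥ v)) ≡ ((k ·ᵥ u) +ᵥ (k ·ᵥ v))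
·ᵥ-distribˡ k [] [] = refl
·ᵥ-distribˡ k (a ∷ u) (b ∷ v) = cong₂ _∷_ (ℤP.*-distribˡ-+ k a b) (·ᵥ-distribˡ k u v)

·ᵥ-distribʳ : ∀ k l (v : Vecℤ d) → ((k + l) ·ᵥ v) ≡ ((k ·ᵥ v) +ᵥ (l ·ᵥ v))
·ᵥ-distribʳ k l [] = refl
·ᵥ-distribʳ k l (a ∷ v) = cong₂ _∷_ (ℤP.*-distribʳ-+ a k l) (·ᵥ-distribʳ k l v)

·ᵥ-assoc : ∀ k l (v : Vecℤ d) → ((k * l) ·ᵥ v) ≡ (k ·ᵥ (l ·ᵥ v))
·ᵥ-assoc k l [] = refl
·ᵥ-assoc k l (a ∷ v) = cong₂ _∷_ (ℤP.*-assoc k l a) (·ᵥ-assoc k l v)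

·ᵥ-identityˡ : (v : Vecℤ d) → (1ℤ ·ᵥ v) ≡ v
·ᵥ-identityˡ [] = refl
·ᵥ-identityˡ (a ∷ v) = cong₂ _∷_ (ℤP.*-identityˡ a) (·ᵥ-identityˡ v)

·ᵥ-suc : ∀ k (v : Vecℤ d) → ((+ suc k) ·ᵥ v) ≡ (v +ᵥ ((+ k) ·ᵥ v))
·ᵥ-suc k [] = refl
·ᵥ-suc k (a ∷ v) = cong₂ _∷_ (ℤP.suc-* (+ k) a) (·ᵥ-suc k v)

·ᵥ-zeroˡ : (v : Vecℤ d) → (0ℤ ·ᵥ v) ≡ 0ᵥ
·ᵥ-zeroˡ [] = refl
·ᵥ-zeroˡ (a ∷ v) = cong₂ _∷_ (ℤP.*-zeroˡ a) (·ᵥ-zeroˡ v)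

·ᵥ-zeroʳ : ∀ k → (k ·ᵥ 0ᵥ {d}) ≡ 0ᵥ
·ᵥ-zeroʳ {zero} k = refl
·ᵥ-zeroʳ {suc d} k = cong₂ _∷_ (ℤP.*-zeroʳ k) (·ᵥ-zeroʳ k)

-ᵥ≡-1·ᵥ : (v : Vecℤ d) → (-ᵥ v) ≡ (-1ℤ ·ᵥ v)
-ᵥ≡-1·ᵥ [] = refl
-ᵥ≡-1·ᵥ (a ∷ v) = cong₂ _∷_ (sym (ℤP.-1*i≡-i a)) (-ᵥ≡-1·ᵥ v)

dot-+ᵥ : (c u v : Vecℤ d) → dot c (u +ᵥ v) ≡ dot c u + dot c v
dot-+ᵥ [] [] [] = refl
dot-+ᵥ (c ∷ cs) (a ∷ u) (b ∷ v) =
  trans (cong₂ _+_ (ℤP.*-distribˡ-+ c a b) (dot-+ᵥ cs u v)) (interchange (c * a) (c * b) _ _)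

dot-·ᵥ : (c : Vecℤ d) → ∀ k v → dot c (k ·ᵥ v) ≡ k * dot c v
dot-·ᵥ [] k [] = sym (ℤP.*-zeroʳ k)
dot-·ᵥ (c ∷ cs) k (a ∷ v) =
  trans (cong₂ _+_ (lemma c k a) (dot-·ᵥ cs k v)) (sym (ℤP.*-distribˡ-+ k (c * a) _))
  where
  lemma : ∀ c k a → c * (k * a) ≡ k * (c * a)
  lemma = solve-∀

dot-0ᵥ : (c : Vecℤ d) → dot c 0ᵥ ≡ 0ℤ
dot-0ᵥ [] = refl
dot-0ᵥ (c ∷ cs) = cong₂ _+_ (ℤP.*-zeroʳ c) (dot-0ᵥ cs)

lincomb-cong : ∀ {x y : Fin n → ℤ} (A : Vec (Vecℤ d) n) → (∀ j → x j ≡ y j) → lincomb x A ≡ lincomb y A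
lincomb-cong [] _ = refl
lincomb-cong (a ∷ A) x≗y = cong₂ (λ k u → (k ·ᵥ a) +ᵥ u) (x≗y zero) (lincomb-cong A (x≗y ∘ suc))

lincomb-+ : ∀ (x y : Fin n → ℤ) (A : Vec (Vecℤ d) n) →
  lincomb (λ j → x j + y j) A ≡ (lincomb x A +ᵥ lincomb y A)
lincomb-+ x y [] = sym (+ᵥ-identityˡ 0ᵥ)
lincomb-+ x y (a ∷ A) =
  trans (cong₂ _+ᵥ_ (·ᵥ-distribʳ (x zero) (y zero) a) (lincomb-+ (x ∘ suc) (y ∘ suc) A))
        (+ᵥ-interchange _ _ _ _)

lincomb-* : ∀ k (x : Fin n → ℤ) (A : Vec (Vecℤ d) n) → lincomb (λ j → k * x j) A ≡ (k ·ᵥ lincomb x A)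
lincomb-* k x [] = sym (·ᵥ-zeroʳ k)
lincomb-* k x (a ∷ A) =
  trans (cong₂ _+ᵥ_ (·ᵥ-assoc k (x zero) a) (lincomb-* k (x ∘ suc) A)) (sym (·ᵥ-distribˡ k _ _))

lincomb-zero : (A : Vec (Vecℤ d) n) → lincomb (const 0ℤ) A ≡ 0ᵥ
lincomb-zero [] = refl
lincomb-zero (a ∷ A) = trans (cong₂ _+ᵥ_ (·ᵥ-zeroˡ a) (lincomb-zero A)) (+ᵥ-identityˡ 0ᵥ)

dot-lincomb : ∀ (c : Vecℤ d) x (A : Vec (Vecℤ d) n) →
  dot c (lincomb x A) ≡ sum (λ j → x j * dot c (lookup A j))
dot-lincomb c x [] = dot-0ᵥ c
dot-lincomb c x (a ∷ A) =
  trans (dot-+ᵥ c _ _) (cong₂ _+_ (dot-·ᵥ c (x zero) a) (dot-lincomb c (x ∘ suc) A))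

0≤i*j : ∀ {i j} → 0ℤ ≤ i → 0ℤ ≤ j → 0ℤ ≤ i * j
0≤i*j (+≤+ {n = m} _) (+≤+ {n = n} _) = subst (0ℤ ≤_) (ℤP.pos-* m n) (+≤+ z≤n)

i≤i*j : ∀ {i j} → 0ℤ ≤ i → 0ℤ ≤ j → j ≢ 0ℤ → i ≤ i * j
i≤i*j (+≤+ {n = m} _) (+≤+ {n = zero} _) j≢0 = contradiction refl j≢0
i≤i*j (+≤+ {n = m} _) (+≤+ {n = suc n} _) _ =
  subst (+ m ≤_) (ℤP.pos-* m (suc n)) (+≤+ (ℕP.m≤m*n m (suc n)))

sum-nonNeg : (f : Fin n → ℤ) → (∀ j → 0ℤ ≤ f j) → 0ℤ ≤ sum f
sum-nonNeg {zero} f _ = ℤP.≤-refl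
sum-nonNeg {suc n} f f≥0 = ℤP.+-mono-≤ (f≥0 zero) (sum-nonNeg (f ∘ suc) (f≥0 ∘ suc))

≤-sum : (f : Fin n → ℤ) → (∀ j → 0ℤ ≤ f j) → ∀ j → f j ≤ sum f
≤-sum f f≥0 zero =
  ℤP.i≤i+j (f zero) (sum (f ∘ suc)) {{ℤ.nonNegative (sum-nonNeg (f ∘ suc) (f≥0 ∘ suc))}}
≤-sum f f≥0 (suc j) =
  ℤP.≤-trans (≤-sum (f ∘ suc) (f≥0 ∘ suc) j) (ℤP.i≤j+i _ (f zero) {{ℤ.nonNegative (f≥0 zero)}})

sum≡0⇒≡0 : (f : Fin n → ℤ) → (∀ j → 0ℤ ≤ f j) → sum f ≡ 0ℤ → ∀ j → f j ≡ 0ℤ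
sum≡0⇒≡0 f f≥0 Σf≡0 j = ℤP.≤-antisym (subst (f j ≤_) Σf≡0 (≤-sum f f≥0 j)) (f≥0 j)

sum-zero : (f : Fin n → ℤ) → (∀ j → f j ≡ 0ℤ) → sum f ≡ 0ℤ
sum-zero {n} f f≡0 = trans (sum-cong-≗ f≡0) (sum-replicate-zero n)

module _ (A : Vec (Vecℤ d) n) where

  InQ-zero : InQ A 0ᵥ
  InQ-zero = const 0 , sym (lincomb-zero A)

  InQ-+ : ∀ {u v} → InQ A u → InQ A v → InQ A (u +ᵥ v)
  InQ-+ {u} {v} (λ₁ , u≡) (λ₂ , v≡) = (λ j → λ₁ j ℕ.+ λ₂ j) , (begin
    u +ᵥ v                                      ≡⟨ cong₂ _+ᵥ_ u≡ v≡ ⟩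
    natcomb λ₁ A +ᵥ natcomb λ₂ A                ≡⟨ lincomb-+ _ _ A ⟨
    lincomb (λ j → + λ₁ j + + λ₂ j) A           ≡⟨ lincomb-cong A (λ j → ℤP.pos-+ (λ₁ j) (λ₂ j)) ⟨
    natcomb (λ j → λ₁ j ℕ.+ λ₂ j) A             ∎)
    where open ≡-Reasoning

  InQ-·ᵥ : ∀ k {v} → InQ A v → InQ A ((+ k) ·ᵥ v)
  InQ-·ᵥ k {v} (λs , v≡) = (λ j → k ℕ.* λs j) , (begin
    (+ k) ·ᵥ v                                  ≡⟨ cong ((+ k) ·ᵥ_) v≡ ⟩
    (+ k) ·ᵥ natcomb λs A                       ≡⟨ lincomb-* (+ k) _ A ⟨
    lincomb (λ j → + k * + λs j) A              ≡⟨ lincomb-cong A (λ j → ℤP.pos-* k (λs j)) ⟨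
    natcomb (λ j → k ℕ.* λs j) A                ∎)
    where open ≡-Reasoning

  -- Writing k = r + q (m + 1) with r ≤ m: m z + k b = (m - r) z + r (z + b) + q ((m + 1) b).
  m·z+k·b∈Q : ∀ {z b} m → InQ A z → InQ A (z +ᵥ b) → InQ A ((+ suc m) ·ᵥ b) →
    ∀ k → InQ A (((+ m) ·ᵥ z) +ᵥ ((+ k) ·ᵥ b))
  m·z+k·b∈Q {z} {b} m z∈Q z+b∈Q [m+1]b∈Q k =
    subst (InQ A) (sym rearrange)
      (InQ-+ (InQ-+ (InQ-·ᵥ (m ∸ r) z∈Q) (InQ-·ᵥ r z+b∈Q)) (InQ-·ᵥ q [m+1]b∈Q))
    where
    r q : ℕ
    r = k % suc m
    q = k / suc m
    m≡ : + m ≡ + (m ∸ r) + + r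
    m≡ = trans (cong +_ (sym (ℕP.m∸n+n≡m (ℕP.≤-pred (m%n<n k (suc m)))))) (ℤP.pos-+ (m ∸ r) r)
    k≡ : + k ≡ + r + + q * + suc m
    k≡ = trans (cong +_ (m≡m%n+[m/n]*n k (suc m)))
               (trans (ℤP.pos-+ r (q ℕ.* suc m)) (cong (λ t → + r + t) (ℤP.pos-* q (suc m))))
    regroup : ∀ {d} M R Q S (z b : Vecℤ d) →
      (((M + R) ·ᵥ z) +ᵥ ((R + Q * S) ·ᵥ b)) ≡ (((M ·ᵥ z) +ᵥ (R ·ᵥ (z +ᵥ b))) +ᵥ (Q ·ᵥ (S ·ᵥ b)))
    regroup M R Q S [] [] = refl
    regroup M R Q S (x ∷ z) (y ∷ b) = cong₂ _∷_ (scalar M R Q S x y) (regroup M R Q S z b)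
      where
      scalar : ∀ M R Q S x y → (M + R) * x + (R + Q * S) * y ≡ (M * x + R * (x + y)) + Q * (S * y)
      scalar = solve-∀
    rearrange : (((+ m) ·ᵥ z) +ᵥ ((+ k) ·ᵥ b)) ≡
                ((((+ (m ∸ r)) ·ᵥ z) +ᵥ ((+ r) ·ᵥ (z +ᵥ b))) +ᵥ ((+ q) ·ᵥ ((+ suc m) ·ᵥ b)))
    rearrange = trans (cong₂ (λ s t → (s ·ᵥ z) +ᵥ (t ·ᵥ b)) m≡ k≡)
                      (regroup (+ (m ∸ r)) (+ r) (+ q) (+ suc m) z b)

Gen-∷⁻ : ∀ {b : Vecℤ d} {L y} → Gen (_∈ (b ∷ L)) y →
  ∃₂ λ k y′ → Gen (_∈ L) y′ × y ≡ (((+ k) ·ᵥ b) +ᵥ y′)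
Gen-∷⁻ {b = b} gen-zero = 0 , 0ᵥ , gen-zero , sym (trans (cong (_+ᵥ 0ᵥ) (·ᵥ-zeroˡ b)) (+ᵥ-identityˡ 0ᵥ))
Gen-∷⁻ {b = b} (gen-add (here refl) g) with k , y′ , g′ , refl ← Gen-∷⁻ g =
  suc k , y′ , g′ , trans (sym (+ᵥ-assoc b _ y′)) (cong (_+ᵥ y′) (sym (·ᵥ-suc k b)))
Gen-∷⁻ (gen-add {b = b′} (there b′∈L) g) with k , y′ , g′ , refl ← Gen-∷⁻ g =
  k , b′ +ᵥ y′ , gen-add b′∈L g′ , +ᵥ-leftComm b′ _ y′

-- Feasibility as a difference of two points of Q

posPart negPart : ℤ → ℕ
posPart (+ n) = n
posPart -[1+ n ] = 0
negPart (+ n) = 0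
negPart -[1+ n ] = suc n

negPart+i≡posPart : ∀ i → + negPart i + i ≡ + posPart i
negPart+i≡posPart (+ n) = refl
negPart+i≡posPart -[1+ n ] = ℤP.+-inverseʳ (+ suc n)

negPart-nonNeg : ∀ {i} → 0ℤ ≤ i → negPart i ≡ 0
negPart-nonNeg (+≤+ _) = refl

FaceDifference : Vec (Vecℤ d) n → Vecℤ d → Vecℤ d → Set
FaceDifference A c b = ∃ λ z → InQ A z × dot c z ≡ 0ℤ × InQ A (z +ᵥ b)

module _ (A : Vec (Vecℤ d) n) (c : Vecℤ d) where

  feasible⇒faceDifference : ∀ {b} → Feasible A c b → FaceDifference A c b
  feasible⇒faceDifference {b} (x , b≡ , x≥0) =
    natcomb (negPart ∘ x) A , (negPart ∘ x , refl) , onFace , (posPart ∘ x , z+b≡)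
    where
    onFace : dot c (natcomb (negPart ∘ x) A) ≡ 0ℤ
    onFace = trans (dot-lincomb c _ A) (sum-zero _ term≡0)
      where
      term≡0 : ∀ j → + negPart (x j) * dot c (lookup A j) ≡ 0ℤ
      term≡0 j with dot c (lookup A j) ℤ.≟ 0ℤ
      ... | yes on = trans (cong (+ negPart (x j) *_) on) (ℤP.*-zeroʳ (+ negPart (x j)))
      ... | no off = cong (λ t → + t * dot c (lookup A j)) (negPart-nonNeg (x≥0 j off))
    z+b≡ : (natcomb (negPart ∘ x) A +ᵥ b) ≡ natcomb (posPart ∘ x) A
    z+b≡ = begin
      natcomb (negPart ∘ x) A +ᵥ b                    ≡⟨ cong (natcomb (negPart ∘ x) A +ᵥ_) b≡ ⟩
      natcomb (negPart ∘ x) A +ᵥ lincomb x A          ≡⟨ lincomb-+ _ x A ⟨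
      lincomb (λ j → + negPart (x j) + x j) A         ≡⟨ lincomb-cong A (negPart+i≡posPart ∘ x) ⟩
      natcomb (posPart ∘ x) A                         ∎
      where open ≡-Reasoning

module _ (A : Vec (Vecℤ d) n) (c : Vecℤ d) (face : IsFaceFunctional A c) where

  offFace-coefficient≡0 : ∀ {μ} → dot c (natcomb μ A) ≡ 0ℤ → ∀ j → dot c (lookup A j) ≢ 0ℤ → μ j ≡ 0
  offFace-coefficient≡0 {μ} cz≡0 j off
    with ℤP.i*j≡0⇒i≡0∨j≡0 (+ μ j) (sum≡0⇒≡0 _ (λ i → 0≤i*j {+ μ i} (+≤+ z≤n) (face i)) Σ≡0 j)
    where
    Σ≡0 : sum (λ j → + μ j * dot c (lookup A j)) ≡ 0ℤ
    Σ≡0 = trans (sym (dot-lincomb c _ A)) cz≡0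
  ... | inj₁ μj≡0 = ℤP.+-injective μj≡0
  ... | inj₂ on = contradiction on off

  faceDifference⇒feasible : ∀ {b} → FaceDifference A c b → Feasible A c b
  faceDifference⇒feasible {b} (z , (μ , z≡) , cz≡0 , (λs , z+b≡)) = x , sym lincomb-x≡b , x≥0
    where
    x : Fin n → ℤ
    x j = + λs j - + μ j
    lincomb-x≡b : lincomb x A ≡ b
    lincomb-x≡b = +ᵥ-cancelˡ z _ _ (begin
      z +ᵥ lincomb x A                        ≡⟨ cong (_+ᵥ lincomb x A) z≡ ⟩
      natcomb μ A +ᵥ lincomb x A              ≡⟨ lincomb-+ _ x A ⟨
      lincomb (λ j → + μ j + x j) A           ≡⟨ lincomb-cong A (λ j → μ+[λ-μ]≡λ (+ μ j) (+ λs j)) ⟩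
      natcomb λs A                            ≡⟨ z+b≡ ⟨
      z +ᵥ b                                  ∎)
      where
      open ≡-Reasoning
      μ+[λ-μ]≡λ : ∀ a b → a + (b - a) ≡ b
      μ+[λ-μ]≡λ = solve-∀
    x≥0 : ∀ j → dot c (lookup A j) ≢ 0ℤ → 0ℤ ≤ x j
    x≥0 j off = subst (λ t → 0ℤ ≤ + λs j - + t)
      (sym (offFace-coefficient≡0 (subst (λ t → dot c t ≡ 0ℤ) z≡ cz≡0) j off)) (+≤+ z≤n)

  almostSaturated⇒feasible : AlmostSaturated A c → ∀ {b} → InQsat A b → Feasible A c b
  almostSaturated⇒feasible (a , (a∈Q , a+Qsat⊆Q) , ca≡0) {b} b∈Qsat =
    faceDifference⇒feasible (a , a∈Q , ca≡0 , a+Qsat⊆Q b b∈Qsat)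

-- A saturation point on F from the differences of the Hilbert basis elements

module _ (A : Vec (Vecℤ d) n) (c : Vecℤ d) where

  -- For b ∈ L with (m + 1) b ∈ Q and z + b ∈ Q, z ∈ Q ∩ F, the summand m z absorbs all multiples of b.
  absorbing-face-point : (L : List (Vecℤ d)) →
    (∀ {b} → b ∈ L → InQsat A b) → (∀ {b} → b ∈ L → FaceDifference A c b) →
    ∃ λ a → InQ A a × dot c a ≡ 0ℤ × (∀ {y} → Gen (_∈ L) y → InQ A (a +ᵥ y))
  absorbing-face-point [] _ _ = 0ᵥ , InQ-zero A , dot-0ᵥ c , λ where
    gen-zero → subst (InQ A) (sym (+ᵥ-identityˡ 0ᵥ)) (InQ-zero A)
    (gen-add () _)
  absorbing-face-point (b ∷ L) L⊆Qsat differences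
    with m , [m+1]b∈Q ← L⊆Qsat (here refl)
       | z , z∈Q , cz≡0 , z+b∈Q ← differences (here refl)
       | a , a∈Q , ca≡0 , a+⟨L⟩⊆Q ← absorbing-face-point L (L⊆Qsat ∘ there) (differences ∘ there)
    = ((+ m) ·ᵥ z) +ᵥ a , InQ-+ A (InQ-·ᵥ A m z∈Q) a∈Q , onFace , absorbs
    where
    onFace : dot c (((+ m) ·ᵥ z) +ᵥ a) ≡ 0ℤ
    onFace = begin
      dot c (((+ m) ·ᵥ z) +ᵥ a)       ≡⟨ dot-+ᵥ c _ a ⟩
      dot c ((+ m) ·ᵥ z) + dot c a    ≡⟨ cong₂ _+_ (dot-·ᵥ c (+ m) z) ca≡0 ⟩
      + m * dot c z + 0ℤ              ≡⟨ cong (λ t → + m * t + 0ℤ) cz≡0 ⟩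
      + m * 0ℤ + 0ℤ                   ≡⟨ cong (_+ 0ℤ) (ℤP.*-zeroʳ (+ m)) ⟩
      0ℤ                              ∎
      where open ≡-Reasoning
    absorbs : ∀ {y} → Gen (_∈ (b ∷ L)) y → InQ A ((((+ m) ·ᵥ z) +ᵥ a) +ᵥ y)
    absorbs g with k , y′ , g′ , refl ← Gen-∷⁻ g =
      subst (InQ A) (+ᵥ-interchange _ _ a y′) (InQ-+ A (m·z+k·b∈Q A m z∈Q z+b∈Q [m+1]b∈Q k) (a+⟨L⟩⊆Q g′))

  allFeasible⇒almostSaturated : ∀ {B} → (∀ {b} → b ∈ B → InQsat A b) →
    (∀ y → InQsat A y → Gen (_∈ B) y) → (∀ {b} → b ∈ B → Feasible A c b) → AlmostSaturated A c
  allFeasible⇒almostSaturated {B} B⊆Qsat Qsat⊆⟨B⟩ feasible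
    with a , a∈Q , ca≡0 , a+⟨B⟩⊆Q ← absorbing-face-point B B⊆Qsat (feasible⇒faceDifference A c ∘ feasible)
    = a , (a∈Q , λ y y∈Qsat → a+⟨B⟩⊆Q (Qsat⊆⟨B⟩ y y∈Qsat)) , ca≡0

Span : Vec (Vecℤ d) m → Pred (Vecℤ d) 0ℓ
Span W v = ∃ λ μ → v ≡ lincomb μ W

module _ (W : Vec (Vecℤ d) m) where

  span-zero : Span W 0ᵥ
  span-zero = const 0ℤ , sym (lincomb-zero W)

  span-+ : ∀ {u v} → Span W u → Span W v → Span W (u +ᵥ v)
  span-+ (μ , refl) (ν , refl) = (λ j → μ j + ν j) , sym (lincomb-+ μ ν W)

  span-·ᵥ : ∀ k {v} → Span W v → Span W (k ·ᵥ v)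
  span-·ᵥ k (μ , refl) = (λ j → k * μ j) , sym (lincomb-* k μ W)

  span-sub : ∀ k {u p} → Span W u → Span W p → Span W (u +ᵥ (-ᵥ (k ·ᵥ p)))
  span-sub k {p = p} u∈W p∈W =
    span-+ u∈W (subst (Span W) (sym (-ᵥ≡-1·ᵥ (k ·ᵥ p))) (span-·ᵥ -1ℤ (span-·ᵥ k p∈W)))

  span-recombine : ∀ k {p v} → Span W p → Span W (v +ᵥ (-ᵥ (k ·ᵥ p))) → Span W v
  span-recombine k {p} {v} p∈W v-kp∈W =
    subst (Span W) (u+[v-u]≡v (k ·ᵥ p) v) (span-+ (span-·ᵥ k p∈W) v-kp∈W)

  span-∷ : ∀ w → Span W ⊆ Span (w ∷ W)
  span-∷ w (μ , refl) = 0ℤ ◂ μ , sym (trans (cong (_+ᵥ lincomb μ W) (·ᵥ-zeroˡ w)) (+ᵥ-identityˡ _))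

span-lookup : (W : Vec (Vecℤ d) m) → ∀ j → Span W (lookup W j)
span-lookup (w ∷ W) zero =
  1ℤ ◂ const 0ℤ , sym (trans (cong₂ _+ᵥ_ (·ᵥ-identityˡ w) (lincomb-zero W)) (+ᵥ-identityʳ w))
span-lookup (w ∷ W) (suc j) = span-∷ W w (span-lookup W j)

span-⊆ : ∀ {W : Vec (Vecℤ d) m} {W′ : Vec (Vecℤ d) k} → (∀ j → Span W′ (lookup W j)) → Span W ⊆ Span W′
span-⊆ {W = []} {W′} _ (μ , refl) = span-zero W′
span-⊆ {W = w ∷ W} {W′} gens (μ , refl) =
  span-+ W′ (span-·ᵥ W′ (μ zero) (gens zero)) (span-⊆ {W = W} {W′} (gens ∘ suc) (μ ∘ suc , refl))

span-∷⇔ : (u : Vecℤ d) (W : Vec (Vecℤ d) m) → ∀ {v} → Span (u ∷ W) v ⇔ ∃ λ q → Span W (v +ᵥ (-ᵥ (q ·ᵥ u)))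
span-∷⇔ u W {v} = mk⇔
  (λ { (μ , refl) → μ zero , μ ∘ suc , u+v-u≡v _ _ })
  (λ { (q , μ , v-qu≡) → q ◂ μ , trans (sym (u+[v-u]≡v (q ·ᵥ u) v)) (cong ((q ·ᵥ u) +ᵥ_) v-qu≡) })

span-∷-cong : ∀ (u : Vecℤ d) {X : Vec (Vecℤ d) m} {Y : Vec (Vecℤ d) k} →
  Span X ≐ Span Y → Span (u ∷ X) ≐ Span (u ∷ Y)
span-∷-cong u {X} {Y} (X⊆Y , Y⊆X) =
  (λ s → let q , r = to (span-∷⇔ u X) s in from (span-∷⇔ u Y) (q , X⊆Y r)) ,
  (λ s → let q , r = to (span-∷⇔ u Y) s in from (span-∷⇔ u X) (q , Y⊆X r))

lincomb-0∷ : ∀ μ (T : Vec (Vecℤ d) m) → lincomb μ (map (0ℤ ∷_) T) ≡ (0ℤ ∷ lincomb μ T)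
lincomb-0∷ μ [] = refl
lincomb-0∷ μ (t ∷ T) =
  trans (cong ((μ zero ·ᵥ (0ℤ ∷ t)) +ᵥ_) (lincomb-0∷ (μ ∘ suc) T))
        (cong (_∷ ((μ zero ·ᵥ t) +ᵥ lincomb (μ ∘ suc) T)) (trans (ℤP.+-identityʳ _) (ℤP.*-zeroʳ (μ zero))))

span-0∷⇔ : (T : Vec (Vecℤ d) m) → ∀ {x v} → Span (map (0ℤ ∷_) T) (x ∷ v) ⇔ (x ≡ 0ℤ × Span T v)
span-0∷⇔ T = mk⇔
  (λ (μ , eq) → let x≡0 , v≡ = ∷-injective (trans eq (lincomb-0∷ μ T)) in x≡0 , μ , v≡)
  (λ { (refl , μ , refl) → μ , sym (lincomb-0∷ μ T) })

span-pivot⇔ : ∀ h (g : Vecℤ d) (T : Vec (Vecℤ d) m) {x v} →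
  Span ((h ∷ g) ∷ map (0ℤ ∷_) T) (x ∷ v) ⇔ ∃ λ q → x ≡ q * h × Span T (v +ᵥ (-ᵥ (q ·ᵥ g)))
span-pivot⇔ h g T {x} = mk⇔
  (λ s → let q , r = to (span-∷⇔ (h ∷ g) (map (0ℤ ∷_) T)) s ; x-qh≡0 , r′ = to (span-0∷⇔ T) r in
         q , ℤP.i-j≡0⇒i≡j x _ x-qh≡0 , r′)
  (λ (q , x≡ , r′) → from (span-∷⇔ (h ∷ g) (map (0ℤ ∷_) T)) (q , from (span-0∷⇔ T) (ℤP.i≡j⇒i-j≡0 x≡ , r′)))

span-pivot? : (∀ {m} (T : Vec (Vecℤ d) m) v → Dec (Span T v)) →
  ∀ (p : Vecℤ (suc d)) (T : Vec (Vecℤ d) m) v → Dec (Span (p ∷ map (0ℤ ∷_) T) v)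
span-pivot? span?ᵈ (h ∷ g) T (x ∷ v) = map′ (from (span-pivot⇔ h g T)) (to (span-pivot⇔ h g T)) quotient?
  where
  -- If h = 0 the quotient q is arbitrary and g joins the generators in dimension d;
  -- otherwise q is forced to be x / h.
  quotient? : Dec (∃ λ q → x ≡ q * h × Span T (v +ᵥ (-ᵥ (q ·ᵥ g))))
  quotient? with h ℤ.≟ 0ℤ
  ... | yes refl =
    map′ (λ (x≡0 , q , r) → q , trans x≡0 (sym (ℤP.*-zeroʳ q)) , r)
         (λ (q , x≡ , r) → trans x≡ (ℤP.*-zeroʳ q) , q , r)
         (x ℤ.≟ 0ℤ ×-dec map′ (to (span-∷⇔ g T)) (from (span-∷⇔ g T)) (span?ᵈ (g ∷ T) v))
  ... | no h≢0 with h ∣? x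
  ...   | no h∤x = no λ (q , x≡ , _) → h∤x (divides q x≡)
  ...   | yes (divides q x≡) =
    map′ (λ r → q , x≡ , r)
         (λ (q′ , x≡′ , r) → subst (λ t → Span T (v +ᵥ (-ᵥ (t ·ᵥ g))))
                                   (ℤP.*-cancelʳ-≡ q′ q h {{ℤ.≢-nonZero h≢0}} (trans (sym x≡′) x≡)) r)
         (span?ᵈ T (v +ᵥ (-ᵥ (q ·ᵥ g))))

-- Integer Bézout identity and column reduction

+∣i∣≡σ*i : ∀ i → ∃ λ σ → + ∣ i ∣ ≡ σ * i
+∣i∣≡σ*i (+ n) = 1ℤ , sym (ℤP.*-identityˡ (+ n))
+∣i∣≡σ*i -[1+ n ] = -1ℤ , sym (ℤP.-1*i≡-i -[1+ n ])

ℕ-bézout⇒ℤ : ∀ i j {g} x y → g ℕ.+ y ℕ.* ∣ j ∣ ≡ x ℕ.* ∣ i ∣ → ∃₂ λ s t → s * i + t * j ≡ + g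
ℕ-bézout⇒ℤ i j {g} x y eq with σ , ∣i∣≡ ← +∣i∣≡σ*i i | τ , ∣j∣≡ ← +∣i∣≡σ*i j =
  + x * σ , - (+ y * τ) , (begin
    (+ x * σ) * i + (- (+ y * τ)) * j          ≡⟨ reassoc (+ x) σ i (+ y) τ j ⟩
    + x * (σ * i) - + y * (τ * j)              ≡⟨ cong₂ (λ u v → + x * u - + y * v) ∣i∣≡ ∣j∣≡ ⟨
    + x * + ∣ i ∣ - + y * + ∣ j ∣              ≡⟨ cong₂ _-_ (ℤP.pos-* x ∣ i ∣) (ℤP.pos-* y ∣ j ∣) ⟨
    + (x ℕ.* ∣ i ∣) - + (y ℕ.* ∣ j ∣)          ≡⟨ cong (λ t → + t - + (y ℕ.* ∣ j ∣)) eq ⟨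
    + (g ℕ.+ y ℕ.* ∣ j ∣) - + (y ℕ.* ∣ j ∣)    ≡⟨ cong (_- + (y ℕ.* ∣ j ∣)) (ℤP.pos-+ g _) ⟩
    (+ g + + (y ℕ.* ∣ j ∣)) - + (y ℕ.* ∣ j ∣)  ≡⟨ cancel (+ g) (+ (y ℕ.* ∣ j ∣)) ⟩
    + g                                        ∎)
  where
  open ≡-Reasoning
  reassoc : ∀ x σ i y τ j → (x * σ) * i + (- (y * τ)) * j ≡ x * (σ * i) - y * (τ * j)
  reassoc = solve-∀
  cancel : ∀ a b → (a + b) - b ≡ a
  cancel = solve-∀

bézout : ∀ i j → ∃₂ λ s t → s * i + t * j ≡ gcd i j
bézout i j with Bézout.identity (gcd-GCD ∣ i ∣ ∣ j ∣)
... | Bézout.+- x y eq = ℕ-bézout⇒ℤ i j x y eq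
... | Bézout.-+ x y eq with t , s , e ← ℕ-bézout⇒ℤ j i y x eq = s , t , trans (ℤP.+-comm (s * i) (t * j)) e

record PivotForm (W : Vec (Vecℤ (suc d)) m) : Set where
  field
    {size} : ℕ
    pivot  : Vecℤ (suc d)
    rest   : Vec (Vecℤ d) size
    span≐  : Span W ≐ Span (pivot ∷ map (0ℤ ∷_) rest)

-- The head e = s a + t b = gcd a b of the pivot p = s w + t g divides a and b, so w − α p and
-- g − β p have head 0, and together with p they span the same lattice as w and g.
gcdStep : (w g : Vecℤ (suc d)) (T : Vec (Vecℤ d) k) → PivotForm (w ∷ g ∷ map (0ℤ ∷_) T)
gcdStep (a ∷ w) (b ∷ g) T
  with s , t , bez ← bézout a b
     | divides α a≡ ← ∣ᵤ⇒∣ {i = a} (gcd[i,j]∣i a b)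
     | divides β b≡ ← ∣ᵤ⇒∣ {i = b} (gcd[i,j]∣j a b)
  = record
    { pivot = p
    ; rest  = w̃ ∷ g̃ ∷ T
    ; span≐ = span-⊆ {W = old} {W′ = new} old⊆new , span-⊆ {W = new} {W′ = old} new⊆old
    }
  where
  p = (s ·ᵥ (a ∷ w)) +ᵥ (t ·ᵥ (b ∷ g))
  p̃ = (s ·ᵥ w) +ᵥ (t ·ᵥ g)
  w̃ = w +ᵥ (-ᵥ (α ·ᵥ p̃))
  g̃ = g +ᵥ (-ᵥ (β ·ᵥ p̃))
  old = (a ∷ w) ∷ (b ∷ g) ∷ map (0ℤ ∷_) T
  new = p ∷ map (0ℤ ∷_) (w̃ ∷ g̃ ∷ T)
  head≡0 : ∀ {c} γ → c ≡ γ * gcd a b → c - γ * (s * a + t * b) ≡ 0ℤ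
  head≡0 γ c≡ = ℤP.i≡j⇒i-j≡0 (trans c≡ (cong (γ *_) (sym bez)))
  w-αp≡ : ((a ∷ w) +ᵥ (-ᵥ (α ·ᵥ p))) ≡ (0ℤ ∷ w̃)
  w-αp≡ = cong (_∷ w̃) (head≡0 α a≡)
  g-βp≡ : ((b ∷ g) +ᵥ (-ᵥ (β ·ᵥ p))) ≡ (0ℤ ∷ g̃)
  g-βp≡ = cong (_∷ g̃) (head≡0 β b≡)
  p∈new = span-lookup new zero
  old⊆new : ∀ j → Span new (lookup old j)
  old⊆new zero = span-recombine new α p∈new (subst (Span new) (sym w-αp≡) (span-lookup new (suc zero)))
  old⊆new (suc zero) =
    span-recombine new β p∈new (subst (Span new) (sym g-βp≡) (span-lookup new (suc (suc zero))))
  old⊆new (suc (suc j)) = span-lookup new (suc (suc (suc j)))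
  p∈old : Span old p
  p∈old = span-+ old (span-·ᵥ old s (span-lookup old zero)) (span-·ᵥ old t (span-lookup old (suc zero)))
  new⊆old : ∀ j → Span old (lookup new j)
  new⊆old zero = p∈old
  new⊆old (suc zero) = subst (Span old) w-αp≡ (span-sub old α (span-lookup old zero) p∈old)
  new⊆old (suc (suc zero)) = subst (Span old) g-βp≡ (span-sub old β (span-lookup old (suc zero)) p∈old)
  new⊆old (suc (suc (suc j))) = span-lookup old (suc (suc j))

pivotForm : (W : Vec (Vecℤ (suc d)) m) → PivotForm W
pivotForm [] = record
  { pivot = 0ᵥ
  ; rest  = []
  ; span≐ = span-⊆ {W = []} {W′ = 0ᵥ ∷ []} (λ ()) , span-⊆ {W = 0ᵥ ∷ []} {W′ = []} (λ { zero → span-zero [] })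
  }
pivotForm (w ∷ W) = record
  { pivot = PivotForm.pivot step
  ; rest  = PivotForm.rest step
  ; span≐ = ≐-trans (span-∷-cong w {X = W} {Y = pivot ∷ map (0ℤ ∷_) rest} span≐) (PivotForm.span≐ step)
  }
  where
  open PivotForm (pivotForm W)
  step = gcdStep w pivot rest

span? : (W : Vec (Vecℤ d) m) → ∀ v → Dec (Span W v)
span? {zero} W [] = yes (span-zero W)
span? {suc d} W v = map′ (proj₂ span≐) (proj₁ span≐) (span-pivot? span? pivot rest v)
  where open PivotForm (pivotForm W)

coset? : (W : Vec (Vecℤ d) m) → ∀ p v → Dec (∃ λ w → v ≡ (p +ᵥ lincomb w W))
coset? W p v = map′
  (λ (w , v-p≡) → w , trans (sym (u+[v-u]≡v p v)) (cong (p +ᵥ_) v-p≡))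
  (λ { (w , refl) → w , u+v-u≡v p _ })
  (span? W (v +ᵥ (-ᵥ p)))

-- Deciding feasibility

∃-Vec? : ∀ {P : Pred (Vec (Fin k) n) 0ℓ} → Decidable P → Dec (∃ P)
∃-Vec? {n = zero} P? = map′ ([] ,_) (λ { ([] , p) → p }) (P? [])
∃-Vec? {n = suc n} P? =
  map′ (λ (i , ys , p) → i ∷ ys , p) (λ { (i ∷ ys , p) → i , ys , p }) (any? λ i → ∃-Vec? (P? ∘ (i ∷_)))

onFace : Vecℤ d → Vecℤ d → Bool
onFace c a = does (dot c a ℤ.≟ 0ℤ)

onFace-false⁻ : ∀ (c a : Vecℤ d) → onFace c a ≡ false → dot c a ≢ 0ℤ
onFace-false⁻ c a off on = contradiction (trans (sym (dec-true (dot c a ℤ.≟ 0ℤ) on)) off) λ ()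

faceMask : Vecℤ d → Vecℤ d → Vecℤ d
faceMask c a = if onFace c a then a else 0ᵥ

lincomb-faceMask : ∀ c w (A : Vec (Vecℤ d) n) →
  lincomb w (map (faceMask c) A) ≡ lincomb (λ j → if onFace c (lookup A j) then w j else 0ℤ) A
lincomb-faceMask c w [] = refl
lincomb-faceMask c w (a ∷ A) = cong₂ _+ᵥ_ (·ᵥ-mask (onFace c a)) (lincomb-faceMask c (w ∘ suc) A)
  where
  ·ᵥ-mask : ∀ β → ((w zero) ·ᵥ (if β then a else 0ᵥ)) ≡ ((if β then w zero else 0ℤ) ·ᵥ a)
  ·ᵥ-mask true = refl
  ·ᵥ-mask false = trans (·ᵥ-zeroʳ (w zero)) (sym (·ᵥ-zeroˡ a))

-- b ∈ Σ y_j a_j + Span {a_j ∈ F}; faceMask replaces the generators off F by 0.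
FaceCoset : Vec (Vecℤ d) n → Vecℤ d → (Fin n → ℕ) → Vecℤ d → Set
FaceCoset A c y b = ∃ λ w → b ≡ (natcomb y A +ᵥ lincomb w (map (faceMask c) A))

module _ (A : Vec (Vecℤ d) n) (c : Vecℤ d) where

  faceCoset⇒feasible : ∀ {y b} → FaceCoset A c y b → Feasible A c b
  faceCoset⇒feasible {y} {b} (w , b≡) = x , b≡lincomb , x≥0
    where
    x : Fin n → ℤ
    x j = + y j + (if onFace c (lookup A j) then w j else 0ℤ)
    b≡lincomb : b ≡ lincomb x A
    b≡lincomb = trans b≡ (trans (cong (natcomb y A +ᵥ_) (lincomb-faceMask c w A)) (sym (lincomb-+ _ _ A)))
    x≥0 : ∀ j → dot c (lookup A j) ≢ 0ℤ → 0ℤ ≤ x j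
    x≥0 j off rewrite dec-false (dot c (lookup A j) ℤ.≟ 0ℤ) off = +≤+ z≤n

module _ (A : Vec (Vecℤ d) n) (c : Vecℤ d) (face : IsFaceFunctional A c) where

  -- Every term x_j (c·a_j) of c·b is non-negative, and c·a_j ≥ 1 off the face.
  offFace-coefficient-bound : ∀ {b x} → b ≡ lincomb x A → (∀ j → dot c (lookup A j) ≢ 0ℤ → 0ℤ ≤ x j) →
    ∀ j → dot c (lookup A j) ≢ 0ℤ → ∣ x j ∣ ℕ.≤ ∣ dot c b ∣
  offFace-coefficient-bound {b} {x} refl x≥0 j off = ℤP.drop‿+≤+ (subst₂ _≤_ ∣x∣≡ ∣cb∣≡ x≤cb)
    where
    term : Fin n → ℤ
    term i = x i * dot c (lookup A i)
    term≥0 : ∀ i → 0ℤ ≤ term i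
    term≥0 i with dot c (lookup A i) ℤ.≟ 0ℤ
    ... | yes on = subst (λ t → 0ℤ ≤ x i * t) (sym on) (subst (0ℤ ≤_) (sym (ℤP.*-zeroʳ (x i))) ℤP.≤-refl)
    ... | no off′ = 0≤i*j (x≥0 i off′) (face i)
    x≤cb : x j ≤ dot c b
    x≤cb = ℤP.≤-trans (i≤i*j (x≥0 j off) (face j) off)
                      (subst (term j ≤_) (sym (dot-lincomb c x A)) (≤-sum term term≥0 j))
    ∣x∣≡ : x j ≡ + ∣ x j ∣
    ∣x∣≡ = sym (ℤP.0≤i⇒+∣i∣≡i (x≥0 j off))
    ∣cb∣≡ : dot c b ≡ + ∣ dot c b ∣
    ∣cb∣≡ = sym (ℤP.0≤i⇒+∣i∣≡i (ℤP.≤-trans (x≥0 j off) x≤cb))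

  feasible⇒boundedFaceCoset : ∀ {b} → Feasible A c b →
    ∃ λ (ys : Vec (Fin (suc ∣ dot c b ∣)) n) → FaceCoset A c (toℕ ∘ lookup ys) b
  feasible⇒boundedFaceCoset {b} (x , b≡ , x≥0) = ys , x , b≡natcomb+lincomb
    where
    y : Fin n → ℕ
    y j = if onFace c (lookup A j) then 0 else ∣ x j ∣
    y≤ : ∀ j → y j ℕ.≤ ∣ dot c b ∣
    y≤ j with onFace c (lookup A j) in eq
    ... | true = z≤n
    ... | false = offFace-coefficient-bound b≡ x≥0 j (onFace-false⁻ c (lookup A j) eq)
    xF : Fin n → ℤ
    xF j = if onFace c (lookup A j) then x j else 0ℤ
    split : ∀ j → x j ≡ + y j + xF j
    split j with onFace c (lookup A j) in eq
    ... | true = sym (ℤP.+-identityˡ (x j))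
    ... | false = trans (sym (ℤP.0≤i⇒+∣i∣≡i (x≥0 j (onFace-false⁻ c (lookup A j) eq)))) (sym (ℤP.+-identityʳ _))
    ys : Vec (Fin (suc ∣ dot c b ∣)) n
    ys = tabulate (λ j → fromℕ< (s≤s (y≤ j)))
    toℕ-lookup : ∀ j → toℕ (lookup ys j) ≡ y j
    toℕ-lookup j = trans (cong toℕ (lookup∘tabulate _ j)) (toℕ-fromℕ< (s≤s (y≤ j)))
    b≡natcomb+lincomb : b ≡ (natcomb (toℕ ∘ lookup ys) A +ᵥ lincomb x (map (faceMask c) A))
    b≡natcomb+lincomb = begin
      b                                          ≡⟨ b≡ ⟩
      lincomb x A                                ≡⟨ lincomb-cong A split ⟩
      lincomb (λ j → + y j + xF j) A             ≡⟨ lincomb-+ _ xF A ⟩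
      natcomb y A +ᵥ lincomb xF A                ≡⟨ cong₂ _+ᵥ_ (lincomb-cong A (λ j → cong +_ (sym (toℕ-lookup j))))
                                                               (sym (lincomb-faceMask c x A)) ⟩
      natcomb (toℕ ∘ lookup ys) A +ᵥ lincomb x (map (faceMask c) A) ∎
      where open ≡-Reasoning

  feasible? : ∀ b → Dec (Feasible A c b)
  feasible? b = map′ (faceCoset⇒feasible A c ∘ proj₂) feasible⇒boundedFaceCoset
    (∃-Vec? λ ys → coset? (map (faceMask c) A) (natcomb (toℕ ∘ lookup ys) A) b)

theorem3p4 : ∀ {d n : ℕ} (A : Vec (Vecℤ d) n) →
    GeneratesLattice A → Pointed A → FullDim A →
    (B : List (Vecℤ d)) → IsHilbertBasis A B →
    (c : Vecℤ d) → IsFaceFunctional A c →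
    NowhereSaturated A c ⇔ (∃ λ b → b ∈ B × ¬ Feasible A c b)
theorem3p4 A _ _ _ B (B⊆Qsat , Qsat⊆⟨B⟩ , _) c face = mk⇔
  (λ nowhere → find (¬All⇒Any¬ (feasible? A c face) B
    (nowhere ∘ allFeasible⇒almostSaturated A c B⊆Qsat Qsat⊆⟨B⟩ ∘ All.lookup)))
  (λ (b , b∈B , infeasible) almost → infeasible (almostSaturated⇒feasible A c face almost (B⊆Qsat b∈B)))
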